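{- Let $G$ be a simple connected graph on $n$ vertices, where $n\ge 4$. Then $$ {\rm SJ}(G)\ge 2\sqrt{\frac{n}{n-1}}\,. $$
   Context: For a simple connected graph $G$ with $n$ vertices and $m$ edges, ${\rm dist}_G(u,v)$ denotes the distance between vertices $u,v$, and the transmission of a vertex $u$ is $w(u)=\sum_{x\in V(G)}{\rm dist}_G(u,x)$. The sum-Balaban index of $G$ is $$ {\rm SJ}(G)=\frac{m}{m-n+2}\sum_{uv\in E(G)}\frac{1}{\sqrt{w(u)+w(v)}}. $$ -}

module Defs where

open import Data.Nat as ℕ using (ℕ; zero; suc)
open import Data.Fin using (Fin; toℕ)
open import Data.Bool using (Bool; true; false; _∧_; if_then_else_)
open import Data.List using (List; []; _∷_; [_]; allFin; concatMap; map; length; foldr)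
open import Data.List.Relation.Unary.All using (All)
open import Data.Product using (_×_; _,_; ∃-syntax; proj₁; proj₂)
open import Data.Sum using (_⊎_)
open import Data.Integer using (+_)
open import Data.Rational using (ℚ; _/_; _+_; _*_; _-_; _<_; _≤_; 0ℚ; 1ℚ)
open import Relation.Binary.PropositionalEquality using (_≡_)

record Graph (n : ℕ) : Set where
  field
    adj    : Fin n → Fin n → Bool
    sym    : ∀ i j → adj i j ≡ adj j i
    irrefl : ∀ i → adj i i ≡ false
open Graph public

data Walk {n : ℕ} (G : Graph n) : Fin n → Fin n → ℕ → Set where
  here : ∀ u → Walk G u u 0
  step : ∀ {u v w k} → adj G u v ≡ true → Walk G v w k → Walk G u w (suc k)

Connected : ∀ {n} → Graph n → Set
Connected {n} G = ∀ (u v : Fin n) → ∃[ k ] Walk G u v k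

IsDistance : ∀ {n} → Graph n → (Fin n → Fin n → ℕ) → Set
IsDistance {n} G d =
  ∀ (u v : Fin n) → Walk G u v (d u v) × (∀ k → Walk G u v k → d u v ℕ.≤ k)

transmission : ∀ {n} → (Fin n → Fin n → ℕ) → Fin n → ℕ
transmission {n} d u = foldr ℕ._+_ 0 (map (d u) (allFin n))

edges : ∀ {n} → Graph n → List (Fin n × Fin n)
edges {n} G =
  concatMap (λ i → concatMap (λ j →
    if adj G i j ∧ (toℕ i ℕ.<ᵇ toℕ j) then [ (i , j) ] else []) (allFin n)) (allFin n)

numEdges : ∀ {n} → Graph n → ℕ
numEdges G = length (edges G)

ℕ→ℚ : ℕ → ℚ
ℕ→ℚ k = (+ k) / 1

sumℚ : List ℚ → ℚ
sumℚ = foldr _+_ 0ℚ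

-- Dedekind-cut style encoding of real numbers built from square roots.
-- r < 1/√a   (a a positive natural):  r ≤ 0, or r² a < 1.
BelowInvSqrt : ℚ → ℕ → Set
BelowInvSqrt r a = (r ≤ 0ℚ) ⊎ (r * r * ℕ→ℚ a < 1ℚ)

-- q < 2 √(n/(n-1))  (n ≥ 2):  q < 0, or q² (n-1) < 4 n.
Below2SqrtRatio : ℚ → ℕ → Set
Below2SqrtRatio q n = (q < 0ℚ) ⊎ (q * q * (ℕ→ℚ n - 1ℚ) < ℕ→ℚ 4 * ℕ→ℚ n)

-- q < SJ(G) where SJ(G) = m/(m-n+2) · Σ_{uv ∈ E} 1/√(w(u)+w(v)).
-- Lower cut of a positive multiple of a finite sum: there are rationals
-- r_e < 1/√(w(u)+w(v)) (one per edge) with q < m/(m-n+2) · Σ r_e;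
-- the last inequality is written multiplied out by the (positive, since G is
-- connected) denominator m-n+2:  q·(m-n+2) < m · Σ r_e.
BelowSJ : ∀ {n} → (G : Graph n) → (Fin n → Fin n → ℕ) → ℚ → Set
BelowSJ {n} G d q =
  ∃[ r ] (All (λ e → BelowInvSqrt (r e) (w (proj₁ e) ℕ.+ w (proj₂ e))) (edges G)
         × (q * (ℕ→ℚ m - ℕ→ℚ n + ℕ→ℚ 2) < ℕ→ℚ m * sumℚ (map r (edges G))))
  where
    w = transmission d
    m = numEdges G

-- SJ(G) ≥ 2 √(n/(n-1)), as inclusion of lower cuts.
SJ≥2SqrtRatio : ∀ {n} → (G : Graph n) → (Fin n → Fin n → ℕ) → Set
SJ≥2SqrtRatio {n} G d = ∀ (q : ℚ) → Below2SqrtRatio q n → BelowSJ G d q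

-- The distances from a vertex u form a down-closed multiset of n numbers (a shortest walk passes
-- through every smaller distance), so w(u) ≤ 0 + 1 + ⋯ + (n-1) = n(n-1)/2.  Mapping every vertex
-- other than a fixed root to the edge joining it to a neighbour one step closer to the root is
-- injective, so m ≥ n - 1.  Hence each term of SJ(G) is at least 1/√(n(n-1)), and
-- SJ(G) ≥ m²/((m-n+2)√(n(n-1))) ≥ 2n/√(n(n-1)) = 2√(n/(n-1)) because m² ≥ 2n(m-n+2) when n ≥ 4.
-- With reals encoded by lower cuts, one rational r just below 1/√(n(n-1)) serves for every edge.

module Submission where

open import Defs hiding (sym)
open import Data.Fin as Fin using (Fin; toℕ)
open import Data.List using (List; []; _∷_; _++_; map; length; allFin; lookup)
open import Data.Nat as ℕ using (ℕ; zero; suc; z≤n; s≤s)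
import Data.Nat.Properties as ℕ
open import Data.Product using (_×_; _,_; proj₁; proj₂; ∃-syntax)
open import Data.Sum using (_⊎_; inj₁; inj₂; [_,_]′)
open import Relation.Binary.PropositionalEquality
open import Relation.Nullary using (yes; no; contradiction)

module CombinatorialBounds where

  open import Data.Bool using (true; _∧_; if_then_else_)
  import Data.Fin.Properties as Fin
  import Data.List.Properties as List
  open import Data.List.Extrema.Nat using (max; argmax-sel; xs≤max; v≤max⁺)
  open import Data.List.Membership.Propositional using (_∈_; lose)
  open import Data.List.Membership.Propositional.Properties
    using (∈-∃++; ∈-map⁺; ∈-map⁻; ∈-allFin; ∈-concatMap⁺)
  open import Data.List.Relation.Binary.Permutation.Propositional using (_↭_; ↭-sym)
  open import Data.List.Relation.Binary.Permutation.Propositional.Properties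
    using (shift; ∈-resp-↭; ↭-length)
  open import Data.List.Relation.Unary.All as All using (All; _∷_)
  open import Data.List.Relation.Unary.Any as Any using (here; there)
  open import Data.List.Relation.Unary.Any.Properties using (lookup-index)
  open import Data.Nat using (_+_; _*_; _∸_; _≤_; _<_)
  open import Data.Nat.ListAction using (sum)
  open import Data.Nat.ListAction.Properties using (sum-↭)
  open import Data.Nat.Tactic.RingSolver using (solve-∀)
  open import Function.Definitions using (Injective)
  open import Relation.Binary.Definitions using (tri<; tri≈; tri>)

  injection⇒≤length : ∀ {A : Set} {k} (L : List A) (f : Fin k → A) →
                      Injective _≡_ _≡_ f → (∀ i → f i ∈ L) → k ≤ length L
  injection⇒≤length L f f-injective f∈L = Fin.injective⇒≤ index-injective
    where
    index-injective : Injective _≡_ _≡_ (λ i → Any.index (f∈L i))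
    index-injective {i} {j} eq = f-injective (begin
      f i                          ≡⟨ lookup-index (f∈L i) ⟩
      lookup L (Any.index (f∈L i)) ≡⟨ cong (lookup L) eq ⟩
      lookup L (Any.index (f∈L j)) ≡⟨ lookup-index (f∈L j) ⟨
      f j                          ∎)
      where open ≡-Reasoning

  ∈-∃↭ : ∀ {A : Set} {x : A} {L} → x ∈ L → ∃[ L′ ] L ↭ x ∷ L′
  ∈-∃↭ x∈L with ys , zs , refl ← ∈-∃++ x∈L = ys ++ zs , shift _ ys zs

  triangle : ℕ → ℕ
  triangle zero    = 0
  triangle (suc k) = k + triangle k

  triangle-double : ∀ k → triangle (suc k) + triangle (suc k) ≡ suc k * k
  triangle-double zero    = refl
  triangle-double (suc k) = begin
    (suc k + t) + (suc k + t)  ≡⟨ regroup k t ⟩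
    2 * suc k + (t + t)        ≡⟨ cong (2 * suc k +_) (triangle-double k) ⟩
    2 * suc k + suc k * k      ≡⟨ expand k ⟩
    suc (suc k) * suc k        ∎
    where
    open ≡-Reasoning
    t : ℕ
    t = triangle (suc k)
    regroup : ∀ k t → (suc k + t) + (suc k + t) ≡ 2 * suc k + (t + t)
    regroup = solve-∀
    expand : ∀ k → 2 * suc k + suc k * k ≡ suc (suc k) * suc k
    expand = solve-∀

  DownClosed : List ℕ → Set
  DownClosed L = ∀ {a j} → a ∈ L → j < a → j ∈ L

  ∈⇒<length : ∀ {L a} → DownClosed L → a ∈ L → a < length L
  ∈⇒<length {L} {a} closed a∈L =
    injection⇒≤length L toℕ Fin.toℕ-injective below-a∈L
    where
    below-a∈L : (i : Fin (suc a)) → toℕ i ∈ L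
    below-a∈L i = [ closed a∈L , (λ i≡a → subst (_∈ L) (sym i≡a) a∈L) ]′
                    (ℕ.m≤n⇒m<n∨m≡n (Fin.toℕ≤pred[n] i))

  DownClosed-drop-max : ∀ {L L′ M} → DownClosed L → All (_≤ M) L → L ↭ M ∷ L′ → DownClosed L′
  DownClosed-drop-max {L} {L′} {M} closed ≤M π {a} {j} a∈L′ j<a =
    stays (∈-resp-↭ π (closed a∈L j<a))
    where
    a∈L : a ∈ L
    a∈L = ∈-resp-↭ (↭-sym π) (there a∈L′)
    stays : j ∈ M ∷ L′ → j ∈ L′
    stays (here refl)  = contradiction (All.lookup ≤M a∈L) (ℕ.<⇒≱ j<a)
    stays (there j∈L′) = j∈L′

  max-∈ : ∀ x xs → max x xs ∈ x ∷ xs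
  max-∈ x xs = [ here , there ]′ (argmax-sel (λ v → v) x xs)

  max-upper : ∀ x xs → All (_≤ max x xs) (x ∷ xs)
  max-upper x xs = v≤max⁺ x xs (inj₁ ℕ.≤-refl) ∷ xs≤max x xs

  sum≤triangle : ∀ {k} L → length L ≡ k → DownClosed L → sum L ≤ triangle k
  sum≤triangle {zero}  []       _   _      = z≤n
  sum≤triangle {suc k} (x ∷ xs) len closed with ∈-∃↭ (max-∈ x xs)
  ... | L′ , π = begin
    sum (x ∷ xs)        ≡⟨ sum-↭ π ⟩
    max x xs + sum L′   ≤⟨ ℕ.+-mono-≤ max≤k (sum≤triangle L′ len′ closed′) ⟩
    k + triangle k      ∎
    where
    open ℕ.≤-Reasoning
    len′ : length L′ ≡ k
    len′ = ℕ.suc-injective (trans (sym (↭-length π)) len)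
    max≤k : max x xs ≤ k
    max≤k = ℕ.≤-pred (subst (max x xs <_) len (∈⇒<length closed (max-∈ x xs)))
    closed′ : DownClosed L′
    closed′ = DownClosed-drop-max closed (max-upper x xs) π

  module _ {n : ℕ} (G : Graph n) where

    _++ʷ_ : ∀ {u v w a b} → Walk G u v a → Walk G v w b → Walk G u w (a + b)
    here _   ++ʷ q = q
    step e p ++ʷ q = step e (p ++ʷ q)

    splitʷ : ∀ j {l u w} → Walk G u w (j + l) → ∃[ y ] Walk G u y j × Walk G y w l
    splitʷ zero    {u = u} p = u , here u , p
    splitʷ (suc j) (step e p) with y , p₁ , p₂ ← splitʷ j p = y , step e p₁ , p₂

    walk-0 : ∀ {u v} → Walk G u v 0 → u ≡ v
    walk-0 (here _) = refl

    walk-1 : ∀ {u v} → Walk G u v 1 → adj G u v ≡ true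
    walk-1 (step e (here _)) = e

    module _ {d : Fin n → Fin n → ℕ} (isDistance : IsDistance G d) where

      distance-split : ∀ {u x} j l → d u x ≡ j + l → ∃[ y ] d u y ≡ j × Walk G y x l
      distance-split {u} {x} j l d≡j+l
        with y , u⇝y , y⇝x ← splitʷ j (subst (Walk G u x) d≡j+l (proj₁ (isDistance u x))) =
        y , ℕ.≤-antisym (proj₂ (isDistance u y) j u⇝y) j≤d , y⇝x
        where
        j≤d : j ≤ d u y
        j≤d = ℕ.+-cancelʳ-≤ l j (d u y)
                (subst (_≤ d u y + l) d≡j+l (proj₂ (isDistance u x) _ (proj₁ (isDistance u y) ++ʷ y⇝x)))

      transmission≤triangle : ∀ u → transmission d u ≤ triangle n
      transmission≤triangle u = sum≤triangle distances length-distances closed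
        where
        distances : List ℕ
        distances = map (d u) (allFin n)
        length-distances : length distances ≡ n
        length-distances = trans (List.length-map (d u) (allFin n)) (List.length-tabulate (λ i → i))
        closed : DownClosed distances
        closed {j = j} a∈ j<a with x , _ , refl ← ∈-map⁻ (d u) a∈
          with y , refl , _ ← distance-split j (d u x ∸ j) (sym (ℕ.m+[n∸m]≡n (ℕ.<⇒≤ j<a))) =
          ∈-map⁺ (d u) (∈-allFin y)

      parent : ∀ {r x} → r ≢ x → ∃[ p ] adj G p x ≡ true × d r x ≡ suc (d r p)
      parent {r} {x} r≢x with d r x in eq
      ... | zero  = contradiction (walk-0 (subst (Walk G r x) eq (proj₁ (isDistance r x)))) r≢x
      ... | suc j with p , refl , p⇝x ← distance-split j 1 (trans eq (ℕ.+-comm 1 j)) =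
        p , walk-1 p⇝x , refl

    adjacent⇒≢ : ∀ {a b} → adj G a b ≡ true → a ≢ b
    adjacent⇒≢ {a} ab refl = contradiction (trans (sym ab) (irrefl G a)) λ ()

    ∈-edges : ∀ {i j} → adj G i j ≡ true → toℕ i < toℕ j → (i , j) ∈ edges G
    ∈-edges {i} {j} ij i<j =
      ∈-concatMap⁺ _ (lose (∈-allFin i) (∈-concatMap⁺ _ (lose (∈-allFin j) listed)))
      where
      listed : (i , j) ∈ (if adj G i j ∧ (toℕ i ℕ.<ᵇ toℕ j) then (i , j) ∷ [] else [])
      listed rewrite ij with toℕ i ℕ.<ᵇ toℕ j | ℕ.<⇒<ᵇ i<j
      ... | true | _ = here refl

    edge-between : ∀ {a b} → adj G a b ≡ true →
                   ∃[ e ] e ∈ edges G × (e ≡ (a , b) ⊎ e ≡ (b , a))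
    edge-between {a} {b} ab with ℕ.<-cmp (toℕ a) (toℕ b)
    ... | tri< a<b _ _ = (a , b) , ∈-edges ab a<b , inj₁ refl
    ... | tri≈ _ a≡b _ = contradiction (Fin.toℕ-injective a≡b) (adjacent⇒≢ ab)
    ... | tri> _ _ b<a = (b , a) , ∈-edges (trans (Graph.sym G b a) ab) b<a , inj₂ refl

  farther : ∀ {n} → (Fin n → ℕ) → Fin n × Fin n → Fin n
  farther h (a , b) with h a ℕ.<? h b
  ... | yes _ = b
  ... | no _  = a

  farther-step : ∀ {n} (h : Fin n → ℕ) {a b e} → h b ≡ suc (h a) →
                 e ≡ (a , b) ⊎ e ≡ (b , a) → farther h e ≡ b
  farther-step h {a} {b} hb (inj₁ refl) with h a ℕ.<? h b
  ... | yes _   = refl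
  ... | no ¬a<b = contradiction (ℕ.≤-reflexive (sym hb)) ¬a<b
  farther-step h {a} {b} hb (inj₂ refl) with h b ℕ.<? h a
  ... | yes b<a = contradiction (subst (_< h a) hb b<a) (ℕ.<-asym (ℕ.n<1+n (h a)))
  ... | no _    = refl

  numEdges≥ : ∀ {n} {G : Graph (suc n)} {d} → IsDistance G d → n ≤ numEdges G
  numEdges≥ {n} {G} {d} isDistance =
    injection⇒≤length (edges G) tree-edge tree-edge-injective (λ i → proj₁ (proj₂ (tree-edge-of i)))
    where
    δ : Fin (suc n) → ℕ
    δ = d Fin.zero
    tree-edge-of : ∀ i → ∃[ e ] e ∈ edges G × farther δ e ≡ Fin.suc i
    tree-edge-of i
      with p , p~i , δi ← parent G isDistance {x = Fin.suc i} (λ ())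
      with e , e∈E , e≡pi ← edge-between G p~i = e , e∈E , farther-step δ δi e≡pi
    tree-edge : Fin n → Fin (suc n) × Fin (suc n)
    tree-edge i = proj₁ (tree-edge-of i)
    tree-edge-injective : Injective _≡_ _≡_ tree-edge
    tree-edge-injective {i} {j} eq = Fin.suc-injective (begin
      Fin.suc i               ≡⟨ proj₂ (proj₂ (tree-edge-of i)) ⟨
      farther δ (tree-edge i) ≡⟨ cong (farther δ) eq ⟩
      farther δ (tree-edge j) ≡⟨ proj₂ (proj₂ (tree-edge-of j)) ⟩
      Fin.suc j               ∎)
      where open ≡-Reasoning

  transmission-pair≤ : ∀ {n} (G : Graph (suc n)) {d} → IsDistance G d →
                       ∀ u v → transmission d u + transmission d v ≤ suc n * n
  transmission-pair≤ {n} G isDistance u v = ℕ.≤-trans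
    (ℕ.+-mono-≤ (transmission≤triangle G isDistance u) (transmission≤triangle G isDistance v))
    (ℕ.≤-reflexive (triangle-double n))

  -- (n + c)² - 2(n + 1)(c + 1) = (n - 1)² + (c - 1)² - 4, which needs n ≥ 3: at least four vertices.
  excess-bound : ∀ {n} c → 3 ≤ n → 2 * suc n * suc c ≤ (n + c) * (n + c)
  excess-bound {suc (suc (suc p))} zero (s≤s (s≤s (s≤s z≤n))) =
    subst (2 * (4 + p) * 1 ≤_) (square p) (ℕ.m≤m+n _ (1 + 4 * p + p * p))
    where
    square : ∀ p → 2 * (4 + p) * 1 + (1 + 4 * p + p * p) ≡ (3 + p + 0) * (3 + p + 0)
    square = solve-∀
  excess-bound {suc (suc (suc p))} (suc c) (s≤s (s≤s (s≤s z≤n))) =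
    subst (2 * (4 + p) * suc (suc c) ≤_) (square p c) (ℕ.m≤m+n _ (c * c + p * p + 4 * p))
    where
    square : ∀ p c → 2 * (4 + p) * suc (suc c) + (c * c + p * p + 4 * p) ≡ (3 + p + suc c) * (3 + p + suc c)
    square = solve-∀

module RationalCuts where

  import Data.Nat.Coprimality as Coprimality
  open import Data.Integer as ℤ using (ℤ)
  import Data.Integer.Properties as ℤ
  open import Data.Integer.Tactic.RingSolver using (solve-∀)
  open import Data.Rational
  open import Data.Rational.Properties
  import Data.Rational.Unnormalised as ℚᵘ
  import Data.Rational.Unnormalised.Properties as ℚᵘ
  open import Data.Rational.Solver using (module +-*-Solver)
  open CombinatorialBounds using (excess-bound)

  toℚᵘ-ℕ→ℚ : ∀ k → toℚᵘ (ℕ→ℚ k) ≡ ℚᵘ.mkℚᵘ (ℤ.+ k) 0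
  toℚᵘ-ℕ→ℚ k = cong toℚᵘ (normalize-coprime (Coprimality.sym (Coprimality.1-coprimeTo k)))

  ℕ→ℚ-suc : ∀ k → ℕ→ℚ (suc k) ≡ 1ℚ + ℕ→ℚ k
  ℕ→ℚ-suc k = toℚᵘ-injective (begin
    toℚᵘ (ℕ→ℚ (suc k))                 ≡⟨ toℚᵘ-ℕ→ℚ (suc k) ⟩
    ℚᵘ.mkℚᵘ (ℤ.+ suc k) 0                ≈⟨ ℚᵘ.*≡* (unit-denominators (ℤ.+ k)) ⟩
    ℚᵘ.1ℚᵘ ℚᵘ.+ ℚᵘ.mkℚᵘ (ℤ.+ k) 0        ≡⟨ cong (ℚᵘ.1ℚᵘ ℚᵘ.+_) (toℚᵘ-ℕ→ℚ k) ⟨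
    toℚᵘ 1ℚ ℚᵘ.+ toℚᵘ (ℕ→ℚ k)          ≈⟨ toℚᵘ-homo-+ 1ℚ (ℕ→ℚ k) ⟨
    toℚᵘ (1ℚ + ℕ→ℚ k)                  ∎)
    where
    open ℚᵘ.≃-Reasoning
    unit-denominators : ∀ (x : ℤ) → (ℤ.+ 1 ℤ.+ x) ℤ.* (ℤ.+ 1 ℤ.* ℤ.+ 1) ≡ (ℤ.+ 1 ℤ.* ℤ.+ 1 ℤ.+ x ℤ.* ℤ.+ 1) ℤ.* ℤ.+ 1
    unit-denominators = solve-∀

  ℕ→ℚ-+ : ∀ a b → ℕ→ℚ (a ℕ.+ b) ≡ ℕ→ℚ a + ℕ→ℚ b
  ℕ→ℚ-+ zero    b = sym (+-identityˡ (ℕ→ℚ b))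
  ℕ→ℚ-+ (suc a) b = begin
    ℕ→ℚ (suc (a ℕ.+ b))        ≡⟨ ℕ→ℚ-suc (a ℕ.+ b) ⟩
    1ℚ + ℕ→ℚ (a ℕ.+ b)         ≡⟨ cong (1ℚ +_) (ℕ→ℚ-+ a b) ⟩
    1ℚ + (ℕ→ℚ a + ℕ→ℚ b)       ≡⟨ +-assoc 1ℚ (ℕ→ℚ a) (ℕ→ℚ b) ⟨
    (1ℚ + ℕ→ℚ a) + ℕ→ℚ b       ≡⟨ cong (_+ ℕ→ℚ b) (ℕ→ℚ-suc a) ⟨
    ℕ→ℚ (suc a) + ℕ→ℚ b        ∎
    where open ≡-Reasoning

  ℕ→ℚ-* : ∀ a b → ℕ→ℚ (a ℕ.* b) ≡ ℕ→ℚ a * ℕ→ℚ b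
  ℕ→ℚ-* zero    b = sym (*-zeroˡ (ℕ→ℚ b))
  ℕ→ℚ-* (suc a) b = begin
    ℕ→ℚ (b ℕ.+ a ℕ.* b)         ≡⟨ ℕ→ℚ-+ b (a ℕ.* b) ⟩
    ℕ→ℚ b + ℕ→ℚ (a ℕ.* b)       ≡⟨ cong (ℕ→ℚ b +_) (ℕ→ℚ-* a b) ⟩
    ℕ→ℚ b + ℕ→ℚ a * ℕ→ℚ b       ≡⟨ cong (_+ ℕ→ℚ a * ℕ→ℚ b) (*-identityˡ (ℕ→ℚ b)) ⟨
    1ℚ * ℕ→ℚ b + ℕ→ℚ a * ℕ→ℚ b  ≡⟨ *-distribʳ-+ (ℕ→ℚ b) 1ℚ (ℕ→ℚ a) ⟨
    (1ℚ + ℕ→ℚ a) * ℕ→ℚ b        ≡⟨ cong (_* ℕ→ℚ b) (ℕ→ℚ-suc a) ⟨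
    ℕ→ℚ (suc a) * ℕ→ℚ b         ∎
    where open ≡-Reasoning

  ℕ→ℚ-mono-≤ : ∀ {a b} → a ℕ.≤ b → ℕ→ℚ a ≤ ℕ→ℚ b
  ℕ→ℚ-mono-≤ {a} {b} a≤b = toℚᵘ-cancel-≤ (subst₂ ℚᵘ._≤_ (sym (toℚᵘ-ℕ→ℚ a)) (sym (toℚᵘ-ℕ→ℚ b))
    (ℚᵘ.*≤* (subst₂ ℤ._≤_ (sym (ℤ.*-identityʳ (ℤ.+ a))) (sym (ℤ.*-identityʳ (ℤ.+ b))) (ℤ.+≤+ a≤b))))

  ℕ→ℚ-mono-< : ∀ {a b} → a ℕ.< b → ℕ→ℚ a < ℕ→ℚ b
  ℕ→ℚ-mono-< {a} {b} a<b = toℚᵘ-cancel-< (subst₂ ℚᵘ._<_ (sym (toℚᵘ-ℕ→ℚ a)) (sym (toℚᵘ-ℕ→ℚ b))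
    (ℚᵘ.*<* (subst₂ ℤ._<_ (sym (ℤ.*-identityʳ (ℤ.+ a))) (sym (ℤ.*-identityʳ (ℤ.+ b))) (ℤ.+<+ a<b))))

  ℕ→ℚ-pred : ∀ n → ℕ→ℚ (suc n) - 1ℚ ≡ ℕ→ℚ n
  ℕ→ℚ-pred n = trans (cong (_- 1ℚ) (ℕ→ℚ-suc n)) (solve 1 (λ a → (con 1ℚ :+ a) :- con 1ℚ := a) refl (ℕ→ℚ n))
    where open +-*-Solver

  ℕ→ℚ-nonNeg : ∀ k → NonNegative (ℕ→ℚ k)
  ℕ→ℚ-nonNeg k = normalize-nonNeg k 1

  ℕ→ℚ-pos : ∀ k → Positive (ℕ→ℚ (suc k))
  ℕ→ℚ-pos k = normalize-pos (suc k) 1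

  sumℚ-const : ∀ {A : Set} r (L : List A) → sumℚ (map (λ _ → r) L) ≡ ℕ→ℚ (length L) * r
  sumℚ-const r []      = sym (*-zeroˡ r)
  sumℚ-const r (_ ∷ L) = begin
    r + sumℚ (map (λ _ → r) L)  ≡⟨ cong (r +_) (sumℚ-const r L) ⟩
    r + ℕ→ℚ (length L) * r      ≡⟨ factor r (ℕ→ℚ (length L)) ⟩
    (1ℚ + ℕ→ℚ (length L)) * r   ≡⟨ cong (_* r) (ℕ→ℚ-suc (length L)) ⟨
    ℕ→ℚ (suc (length L)) * r    ∎
    where
    open ≡-Reasoning
    open +-*-Solver
    factor : ∀ r x → r + x * r ≡ (1ℚ + x) * r
    factor = solve 2 (λ r x → r :+ x :* r := (con 1ℚ :+ x) :* r) refl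

  p<p+q : ∀ p q → .{{Positive q}} → p < p + q
  p<p+q p q = subst (_< p + q) (+-identityʳ p) (+-monoʳ-< p (positive⁻¹ q))

  below-invSqrt-rounded : ∀ t B → .{{Positive t}} → .{{NonNegative B}} →
                          t * t * B < 1ℚ → ∃[ r ] t < r × r * r * B < 1ℚ
  below-invSqrt-rounded t B t²B<1 = r , p<p+q t (t * y * ½) , r²B<1
    where
    open +-*-Solver
    y r : ℚ
    y = 1ℚ - t * t * B
    r = t + t * y * ½
    instance
      y-pos : Positive y
      y-pos = positive (subst (_< y) (+-inverseʳ (t * t * B)) (+-monoˡ-< (- (t * t * B)) t²B<1))
      ty½-pos : Positive (t * y * ½)
      ty½-pos = pos*pos⇒pos (t * y) {{pos*pos⇒pos t y}} ½
      slack-pos : Positive (y * y * (ℕ→ℚ 3 + y) * (½ * ½))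
      slack-pos = pos*pos⇒pos (y * y * (ℕ→ℚ 3 + y))
                    {{pos*pos⇒pos (y * y) {{pos*pos⇒pos y y}} (ℕ→ℚ 3 + y) {{nonNeg+pos⇒pos (ℕ→ℚ 3) {{ℕ→ℚ-nonNeg 3}} y}}}}
                    (½ * ½)
    -- r = t(1 + y/2), so r²B = (1 - y)(1 + y/2)² = 1 - y²(3 + y)/4
    identity : ∀ t B → (t + t * (1ℚ - t * t * B) * ½) * (t + t * (1ℚ - t * t * B) * ½) * B
                       + (1ℚ - t * t * B) * (1ℚ - t * t * B) * (ℕ→ℚ 3 + (1ℚ - t * t * B)) * (½ * ½) ≡ 1ℚ
    identity = solve 2 (λ t B →
      (t :+ t :* (con 1ℚ :- t :* t :* B) :* con ½) :* (t :+ t :* (con 1ℚ :- t :* t :* B) :* con ½) :* B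
      :+ (con 1ℚ :- t :* t :* B) :* (con 1ℚ :- t :* t :* B) :* (con (ℕ→ℚ 3) :+ (con 1ℚ :- t :* t :* B)) :* (con ½ :* con ½)
      := con 1ℚ) refl
    r²B<1 : r * r * B < 1ℚ
    r²B<1 = subst (r * r * B <_) (identity t B) (p<p+q (r * r * B) _)

  below-invSqrt-scaled : ∀ x S B → .{{Positive x}} → .{{Positive S}} → .{{NonNegative B}} →
                         x * x * B < S * S → ∃[ r ] r * r * B < 1ℚ × x < S * r
  below-invSqrt-scaled x S B x²B<S² =
    let r , t<r , r²B<1 = below-invSqrt-rounded t B t²B<1
    in r , r²B<1 , subst (_< S * r) St≡x (*-monoʳ-<-pos S t<r)
    where
    open +-*-Solver
    instance
      S-nonZero : NonZero S
      S-nonZero = pos⇒nonZero S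
    u t : ℚ
    u = 1/ S
    t = x * u
    instance
      t-pos : Positive t
      t-pos = pos*pos⇒pos x u {{1/pos⇒pos S}}
      S²-nonNeg : NonNegative (S * S)
      S²-nonNeg = pos⇒nonNeg (S * S) {{pos*pos⇒pos S S}}
    uS≡1 : u * S ≡ 1ℚ
    uS≡1 = *-inverseˡ S
    St≡x : S * t ≡ x
    St≡x = begin
      S * (x * u)   ≡⟨ solve 3 (λ S x u → S :* (x :* u) := x :* (u :* S)) refl S x u ⟩
      x * (u * S)   ≡⟨ cong (x *_) uS≡1 ⟩
      x * 1ℚ        ≡⟨ *-identityʳ x ⟩
      x             ∎
      where open ≡-Reasoning
    t²B<1 : t * t * B < 1ℚ
    t²B<1 = *-cancelʳ-<-nonNeg (S * S) (begin-strict
      t * t * B * (S * S)                ≡⟨ solve 4 (λ x u B S → x :* u :* (x :* u) :* B :* (S :* S)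
                                                     := x :* x :* B :* ((u :* S) :* (u :* S))) refl x u B S ⟩
      x * x * B * ((u * S) * (u * S))    ≡⟨ cong (λ z → x * x * B * (z * z)) uS≡1 ⟩
      x * x * B * (1ℚ * 1ℚ)              ≡⟨ *-identityʳ (x * x * B) ⟩
      x * x * B                          <⟨ x²B<S² ⟩
      S * S                              ≡⟨ *-identityˡ (S * S) ⟨
      1ℚ * (S * S)                       ∎)
      where open ≤-Reasoning

  Below2SqrtRatio⇒positive : ∀ {n q} → Below2SqrtRatio q (suc n) →
    ∃[ q′ ] Positive q′ × q ≤ q′ × q′ * q′ * ℕ→ℚ n < ℕ→ℚ 4 * ℕ→ℚ (suc n)
  Below2SqrtRatio⇒positive {n} {q} q<bound with 0ℚ <? q | q<bound
  ... | yes 0<q | inj₁ q<0   = contradiction q<0 (<-asym 0<q)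
  ... | yes 0<q | inj₂ q²<4n =
    q , positive 0<q , ≤-refl , subst (λ z → q * q * z < ℕ→ℚ 4 * ℕ→ℚ (suc n)) (ℕ→ℚ-pred n) q²<4n
  ... | no  0≮q | _          = 1ℚ , _ , ≤-trans (≮⇒≥ 0≮q) (nonNegative⁻¹ 1ℚ) , (begin-strict
    1ℚ * 1ℚ * ℕ→ℚ n             ≡⟨ *-identityˡ (ℕ→ℚ n) ⟩
    ℕ→ℚ n                       <⟨ ℕ→ℚ-mono-< (ℕ.m≤n*m (suc n) 4) ⟩
    ℕ→ℚ (4 ℕ.* suc n)           ≡⟨ ℕ→ℚ-* 4 (suc n) ⟩
    ℕ→ℚ 4 * ℕ→ℚ (suc n)         ∎)
    where open ≤-Reasoning

  [qk]²n[n-1]<m⁴ : ∀ {n k m} q → 2 ℕ.* suc n ℕ.* suc k ℕ.≤ m ℕ.* m →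
                q * q * ℕ→ℚ n < ℕ→ℚ 4 * ℕ→ℚ (suc n) →
                (q * ℕ→ℚ (suc k)) * (q * ℕ→ℚ (suc k)) * ℕ→ℚ (suc n ℕ.* n) < (ℕ→ℚ m * ℕ→ℚ m) * (ℕ→ℚ m * ℕ→ℚ m)
  [qk]²n[n-1]<m⁴ {n} {k} {m} q 2nk≤m² q²<4n = begin-strict
    (q * K) * (q * K) * ℕ→ℚ (suc n ℕ.* n)  ≡⟨ cong ((q * K) * (q * K) *_) (ℕ→ℚ-* (suc n) n) ⟩
    (q * K) * (q * K) * (N * N₁)           ≡⟨ solve 4 (λ q K N N₁ → q :* K :* (q :* K) :* (N :* N₁)
                                                := q :* q :* N₁ :* (N :* (K :* K))) refl q K N N₁ ⟩
    q * q * N₁ * (N * (K * K))             <⟨ *-monoˡ-<-pos (N * (K * K)) {{NK²-pos}} q²<4n ⟩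
    ℕ→ℚ 4 * N * (N * (K * K))              ≡⟨ solve 2 (λ N K → con (ℕ→ℚ 4) :* N :* (N :* (K :* K))
                                                := con (ℕ→ℚ 2) :* N :* K :* (con (ℕ→ℚ 2) :* N :* K)) refl N K ⟩
    (ℕ→ℚ 2 * N * K) * (ℕ→ℚ 2 * N * K)      ≡⟨ cong₂ _*_ ℕ→ℚ-2nk ℕ→ℚ-2nk ⟨
    ℕ→ℚ 2nk * ℕ→ℚ 2nk                      ≡⟨ ℕ→ℚ-* 2nk 2nk ⟨
    ℕ→ℚ (2nk ℕ.* 2nk)                      ≤⟨ ℕ→ℚ-mono-≤ (ℕ.*-mono-≤ 2nk≤m² 2nk≤m²) ⟩
    ℕ→ℚ (m ℕ.* m ℕ.* (m ℕ.* m))            ≡⟨ trans (ℕ→ℚ-* (m ℕ.* m) (m ℕ.* m)) (cong₂ _*_ (ℕ→ℚ-* m m) (ℕ→ℚ-* m m)) ⟩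
    (ℕ→ℚ m * ℕ→ℚ m) * (ℕ→ℚ m * ℕ→ℚ m)      ∎
    where
    open ≤-Reasoning
    open +-*-Solver
    N N₁ K : ℚ
    N = ℕ→ℚ (suc n)
    N₁ = ℕ→ℚ n
    K = ℕ→ℚ (suc k)
    2nk : ℕ
    2nk = 2 ℕ.* suc n ℕ.* suc k
    ℕ→ℚ-2nk : ℕ→ℚ 2nk ≡ ℕ→ℚ 2 * N * K
    ℕ→ℚ-2nk = trans (ℕ→ℚ-* (2 ℕ.* suc n) (suc k)) (cong (_* K) (ℕ→ℚ-* 2 (suc n)))
    NK²-pos : Positive (N * (K * K))
    NK²-pos = pos*pos⇒pos N {{ℕ→ℚ-pos n}} (K * K) {{pos*pos⇒pos K {{ℕ→ℚ-pos k}} K {{ℕ→ℚ-pos k}}}}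

  BelowInvSqrt-antimono : ∀ {r a b} → a ℕ.≤ b → BelowInvSqrt r b → BelowInvSqrt r a
  BelowInvSqrt-antimono     _   (inj₁ r≤0)   = inj₁ r≤0
  BelowInvSqrt-antimono {r} a≤b (inj₂ r²b<1) with r ≤? 0ℚ
  ... | yes r≤0 = inj₁ r≤0
  ... | no  r≰0 = inj₂ (≤-<-trans (*-monoˡ-≤-nonNeg (r * r) {{r²-nonNeg}} (ℕ→ℚ-mono-≤ a≤b)) r²b<1)
    where
    r²-nonNeg : NonNegative (r * r)
    r²-nonNeg = pos⇒nonNeg (r * r) {{pos*pos⇒pos r {{r-pos}} r {{r-pos}}}}
      where
      r-pos : Positive r
      r-pos = positive (≰⇒> r≰0)

  ℕ→ℚ-excess : ∀ a c → ℕ→ℚ (a ℕ.+ c) - ℕ→ℚ (suc a) + ℕ→ℚ 2 ≡ ℕ→ℚ (suc c)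
  ℕ→ℚ-excess a c = begin
    ℕ→ℚ (a ℕ.+ c) - ℕ→ℚ (suc a) + ℕ→ℚ 2       ≡⟨ cong₂ (λ x y → x - y + ℕ→ℚ 2) (ℕ→ℚ-+ a c) (ℕ→ℚ-suc a) ⟩
    (ℕ→ℚ a + ℕ→ℚ c) - (1ℚ + ℕ→ℚ a) + ℕ→ℚ 2    ≡⟨ solve 2 (λ a c → (a :+ c) :- (con 1ℚ :+ a) :+ con (ℕ→ℚ 2)
                                                   := con 1ℚ :+ c) refl (ℕ→ℚ a) (ℕ→ℚ c) ⟩
    1ℚ + ℕ→ℚ c                                 ≡⟨ ℕ→ℚ-suc c ⟨
    ℕ→ℚ (suc c)                                ∎
    where
    open ≡-Reasoning
    open +-*-Solver

  SJ-constant-witness : ∀ {n m} q → 3 ℕ.≤ n → n ℕ.≤ m → Below2SqrtRatio q (suc n) →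
           ∃[ r ] BelowInvSqrt r (suc n ℕ.* n) × q * (ℕ→ℚ m - ℕ→ℚ (suc n) + ℕ→ℚ 2) < ℕ→ℚ m * (ℕ→ℚ m * r)
  SJ-constant-witness {n@(suc n₁)} q 3≤n n≤m q<bound with c , refl ← ℕ.m≤n⇒∃[o]m+o≡n n≤m =
    let q′ , q′-pos , q≤q′ , q′-bound = Below2SqrtRatio⇒positive {n} q<bound
        r , r²B<1 , q′K<M²r = below-invSqrt-scaled (q′ * K) (M * M) (ℕ→ℚ (suc n ℕ.* n))
                                {{pos*pos⇒pos q′ {{q′-pos}} K {{ℕ→ℚ-pos c}}}} {{M²-pos}} {{ℕ→ℚ-nonNeg (suc n ℕ.* n)}}
                                ([qk]²n[n-1]<m⁴ {n} {c} {n ℕ.+ c} q′ 2nk≤m² q′-bound)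
    in r , inj₂ r²B<1 , (begin-strict
      q * (M - ℕ→ℚ (suc n) + ℕ→ℚ 2)  ≡⟨ cong (q *_) (ℕ→ℚ-excess n c) ⟩
      q * K                          ≤⟨ *-monoʳ-≤-nonNeg K {{ℕ→ℚ-nonNeg (suc c)}} q≤q′ ⟩
      q′ * K                         <⟨ q′K<M²r ⟩
      M * M * r                      ≡⟨ *-assoc M M r ⟩
      M * (M * r)                    ∎)
    where
    open ≤-Reasoning
    K M : ℚ
    K = ℕ→ℚ (suc c)
    M = ℕ→ℚ (n ℕ.+ c)
    2nk≤m² : 2 ℕ.* suc n ℕ.* suc c ℕ.≤ (n ℕ.+ c) ℕ.* (n ℕ.+ c)
    2nk≤m² = excess-bound c 3≤n
    M²-pos : Positive (M * M)
    M²-pos = pos*pos⇒pos M {{ℕ→ℚ-pos (n₁ ℕ.+ c)}} M {{ℕ→ℚ-pos (n₁ ℕ.+ c)}}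

open CombinatorialBounds using (numEdges≥; transmission-pair≤)
open RationalCuts using (SJ-constant-witness; BelowInvSqrt-antimono; sumℚ-const)
open import Data.Rational using (_*_; _<_)
import Data.List.Relation.Unary.All as All

theorem1 : (n : ℕ) → 4 ℕ.≤ n → (G : Graph n) → Connected G →
           (d : Fin n → Fin n → ℕ) → IsDistance G d → SJ≥2SqrtRatio G d
theorem1 (suc n) (s≤s 3≤n) G _ d isDistance q q<bound =
  let r , r<1/√B , q<m²r = SJ-constant-witness q 3≤n (numEdges≥ isDistance) q<bound
  in (λ _ → r) ,
     All.tabulate (λ {(u , v)} _ → BelowInvSqrt-antimono (transmission-pair≤ G isDistance u v) r<1/√B) ,
     subst (λ s → q * _ < ℕ→ℚ (numEdges G) * s) (sym (sumℚ-const r (edges G))) q<m²r
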